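{- Let $f,g,h$ be integers with $2<f=g<h$. Every connected graph $G$ with $\chi(G)=f$, $\Gamma(G)=g$ and $\psi(G)=h$ has at least $2h-f+1$ vertices; i.e., $n(f,g,h)\ge 2h-f+1$.
   Context: A complete $k$-coloring of a graph is a proper coloring with exactly $k$ colors in which any two color classes are joined by at least one edge; $\psi$ (achromatic number) is the maximum such $k$, $\chi$ is the chromatic number. A Grundy coloring is a proper coloring $\varphi:V\to\{1,\dots,k\}$ in which every vertex $v$ has a neighbor of color $i$ for every $1\le i<\varphi(v)$; the Grundy number $\Gamma$ is the maximum $k$ for which such a coloring exists. $n(f,g,h)$ is the minimum number of vertices of a connected graph with $\chi=f$, $\Gamma=g$, $\psi=h$. -}

module Defs where

open import Data.Nat using (ℕ; _≤_; _<_)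
open import Data.Fin using (Fin; toℕ)
open import Data.Product using (Σ; ∃; _×_; _,_)
open import Relation.Nullary using (¬_)
open import Relation.Binary.PropositionalEquality using (_≡_; _≢_)

record Graph (n : ℕ) : Set₁ where
  field
    Adj     : Fin n → Fin n → Set
    sym     : ∀ {u v} → Adj u v → Adj v u
    irrefl  : ∀ {u} → ¬ Adj u u
open Graph public

module _ {n : ℕ} (G : Graph n) where

  data Walk : Fin n → Fin n → Set where
    here : ∀ {u} → Walk u u
    step : ∀ {u w v} → Adj G u w → Walk w v → Walk u v

  Connected : Set
  Connected = ∀ u v → Walk u v

  -- proper coloring with colour set Fin k (colours 0..k-1 stand for 1..k)
  Proper : (k : ℕ) → (Fin n → Fin k) → Set
  Proper k c = ∀ u v → Adj G u v → c u ≢ c v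

  Onto : (k : ℕ) → (Fin n → Fin k) → Set
  Onto k c = ∀ (i : Fin k) → ∃ λ v → c v ≡ i

  CompleteColoring : (k : ℕ) → (Fin n → Fin k) → Set
  CompleteColoring k c =
    Proper k c × Onto k c ×
    (∀ (i j : Fin k) → i ≢ j → ∃ λ u → ∃ λ v → Adj G u v × c u ≡ i × c v ≡ j)

  GrundyColoring : (k : ℕ) → (Fin n → Fin k) → Set
  GrundyColoring k c =
    Proper k c × Onto k c ×
    (∀ v (i : Fin k) → toℕ i < toℕ (c v) → ∃ λ u → Adj G v u × c u ≡ i)

  ChromaticNumber : ℕ → Set
  ChromaticNumber f =
    (Σ (Fin n → Fin f) (Proper f)) ×
    (∀ k → Σ (Fin n → Fin k) (Proper k) → f ≤ k)

  GrundyNumber : ℕ → Set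
  GrundyNumber g =
    (Σ (Fin n → Fin g) (GrundyColoring g)) ×
    (∀ k → Σ (Fin n → Fin k) (GrundyColoring k) → k ≤ g)

  AchromaticNumber : ℕ → Set
  AchromaticNumber h =
    (Σ (Fin n → Fin h) (CompleteColoring h)) ×
    (∀ k → Σ (Fin n → Fin k) (CompleteColoring k) → k ≤ h)

module Submission where

-- Let c be a complete h-colouring of G and f = Γ(G) < h.  Every colour class is
-- nonempty, so if s classes are singletons then n ≥ s + 2(h − s): 2h ≤ n + s.
-- Suppose n ≤ 2h − f.  Then there are f singleton classes T₁, …, T_f and, as
-- f < h, a further class T₀.  Colouring T₀ with 0 and the vertex of T_j with j
-- is a partial Grundy colouring, since completeness joins the vertex of T_j to
-- every other class.  Extending it greedily (each new vertex gets the least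
-- colour missing among its coloured neighbours) yields a Grundy colouring with
-- more than f colours, contradicting Γ(G) = f.
--
-- Greedy extension needs decidable adjacency; as the conclusion is decidable we
-- argue by contradiction, under which adjacency may be assumed decidable.

open import Defs
open import Data.Nat using (ℕ; _+_; _∸_; _*_; _≤_; _<_)
open import Relation.Binary.PropositionalEquality using (_≡_)

open import Data.Nat using (zero; suc; z≤n; s≤s; s≤s⁻¹)
open import Data.Nat.Properties
  using (+-commutativeSemigroup; +-0-monoid; +-mono-≤; +-monoˡ-≤; *-zeroʳ; *-comm;
         +-cancelˡ-≤; ≤-trans; ≤-reflexive; m≤m+n; m≤n+m; <⇒≱; ≰⇒>; 1+n≰n;
         m∸n+n≡m; m<1+n⇒m≤n; m≤n⇒m<n∨m≡n; m≤n⇒m≤1+n; <⇒≤; +-comm; <-trans;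
         <-irrefl; _≤?_; module ≤-Reasoning)
  renaming (_≟_ to _≟ℕ_)
open import Algebra.Properties.CommutativeSemigroup +-commutativeSemigroup
  using (interchange)
open import Algebra.Properties.Monoid.Sum +-0-monoid using (sum; sum-syntax)
open import Data.Bool using (if_then_else_)
open import Data.Fin using (Fin; zero; suc; toℕ; fromℕ; fromℕ<; inject)
open import Data.Fin.Properties
  using (_≟_; any?; toℕ-injective; toℕ<n; toℕ-fromℕ; toℕ-fromℕ<; toℕ-inject;
         toℕ≤pred[n]; injective⇒≤; ¬∀⟶∃¬; ¬∀⟶∃¬-smallest; ∀-cons; suc-injective)
open import Data.List using (List; []; _∷_; allFin)
open import Data.List.Extrema.Nat using (argmax; f[xs]≤f[argmax])
open import Data.List.Membership.Propositional.Properties using (∈-allFin)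
open import Data.List.Relation.Unary.All using (All; []; _∷_)
import Data.List.Relation.Unary.All as All
open import Data.Maybe using (Maybe; just; nothing)
open import Data.Maybe.Properties using (just-injective) renaming (≡-dec to ≡-dec-Maybe)
open import Data.Product using (Σ; ∃; _×_; _,_; proj₁; proj₂)
open import Data.Sum using (_⊎_; inj₁; inj₂)
open import Data.Vec.Functional using (updateAt) renaming (_∷_ to _∷ᵛ_)
open import Data.Vec.Functional.Properties using (updateAt-updates; updateAt-minimal)
open import Function using (_∘_; const)
open import Function.Definitions using (Injective)
open import Relation.Nullary using (¬_; Dec; yes; no; does; contradiction)
open import Relation.Nullary.Decidable using (decidable-stable; _×-dec_)
open import Relation.Nullary.Decidable.Core using (¬¬-excluded-middle)
open import Relation.Binary.PropositionalEquality
  using (_≢_; refl; trans; cong; cong₂; subst) renaming (sym to ≡-sym)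

private
  Inj : ∀ {m k} → (Fin m → Fin k) → Set
  Inj = Injective _≡_ _≡_

𝟙 : ∀ {p} {P : Set p} → Dec P → ℕ
𝟙 d = if does d then 1 else 0

𝟙-yes : ∀ {p} {P : Set p} (d : Dec P) → P → 𝟙 d ≡ 1
𝟙-yes (yes _) _ = refl
𝟙-yes (no ¬p) p = contradiction p ¬p

sum-+ : ∀ {k} (a b : Fin k → ℕ) → ∑[ i < k ] (a i + b i) ≡ sum a + sum b
sum-+ {zero}  a b = refl
sum-+ {suc k} a b =
  trans (cong (a zero + b zero +_) (sum-+ (a ∘ suc) (b ∘ suc)))
        (interchange (a zero) (b zero) (sum (a ∘ suc)) (sum (b ∘ suc)))

sum-mono : ∀ {k} {a b : Fin k → ℕ} → (∀ i → a i ≤ b i) → sum a ≤ sum b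
sum-mono {zero}  _   = z≤n
sum-mono {suc k} a≤b = +-mono-≤ (a≤b zero) (sum-mono (a≤b ∘ suc))

sum-const : ∀ k m → ∑[ i < k ] m ≡ k * m
sum-const zero    m = refl
sum-const (suc k) m = cong (m +_) (sum-const k m)

sum-point : ∀ {k} (x : Fin k) → ∑[ i < k ] 𝟙 (x ≟ i) ≡ 1
sum-point {suc k} zero    = cong suc (trans (sum-const k 0) (*-zeroʳ k))
sum-point {suc k} (suc x) = sum-point x

count : ∀ {k} {P : Fin k → Set} → (∀ i → Dec (P i)) → ℕ
count {k} P? = ∑[ i < k ] 𝟙 (P? i)

cons-injective : ∀ {m k} {x : Fin k} {t : Fin m → Fin k} →
  (∀ j → t j ≢ x) → Inj t → Inj (x ∷ᵛ t)
cons-injective fresh inj {zero}  {zero}  _ = refl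
cons-injective fresh inj {zero}  {suc j} e = contradiction (≡-sym e) (fresh j)
cons-injective fresh inj {suc i} {zero}  e = contradiction e (fresh i)
cons-injective fresh inj {suc i} {suc j} e = cong suc (inj e)

choose : ∀ {k} {P : Fin k → Set} (P? : ∀ i → Dec (P i)) {m} → m ≤ count P? →
  Σ (Fin m → Fin k) λ t → Inj t × (∀ j → P (t j))
choose P? {zero} _ = (λ ()) , (λ { {()} }) , (λ ())
choose {suc k} P? {suc m} m≤ with P? zero
... | yes p =
  let t , inj , sat = choose (P? ∘ suc) (s≤s⁻¹ m≤)
  in zero ∷ᵛ suc ∘ t , cons-injective (λ _ ()) (inj ∘ suc-injective) , ∀-cons p sat
... | no _ =
  let t , inj , sat = choose (P? ∘ suc) m≤
  in suc ∘ t , inj ∘ suc-injective , sat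

missed-value : ∀ {f h} → f < h → (t : Fin f → Fin h) → ∃ λ x → ∀ j → t j ≢ x
missed-value {f} {h} f<h t =
  let x , unhit = ¬∀⟶∃¬ h (λ x → ∃ λ j → t j ≡ x) (λ x → any? (λ j → t j ≟ x)) not-onto
  in x , λ j e → unhit (j , e)
  where
  not-onto : ¬ (∀ x → ∃ λ j → t j ≡ x)
  not-onto hit = <⇒≱ f<h (injective⇒≤ {f = proj₁ ∘ hit} λ {x} {y} e →
    trans (≡-sym (proj₂ (hit x))) (trans (cong t e) (proj₂ (hit y))))

classSize : ∀ {n h} → (Fin n → Fin h) → Fin h → ℕ
classSize {n} c i = ∑[ v < n ] 𝟙 (c v ≟ i)

sum-classSize : ∀ {n h} (c : Fin n → Fin h) → ∑[ i < h ] classSize c i ≡ n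
sum-classSize {zero}  {h} c = trans (sum-const h 0) (*-zeroʳ h)
sum-classSize {suc n} c =
  trans (sum-+ (λ i → 𝟙 (c zero ≟ i)) (classSize (c ∘ suc)))
        (cong₂ _+_ (sum-point (c zero)) (sum-classSize (c ∘ suc)))

classSize-pos : ∀ {n h} (c : Fin n → Fin h) {i} v → c v ≡ i → 1 ≤ classSize c i
classSize-pos c zero    cv = ≤-trans (≤-reflexive (≡-sym (𝟙-yes (c zero ≟ _) cv))) (m≤m+n _ _)
classSize-pos c (suc v) cv = ≤-trans (classSize-pos (c ∘ suc) v cv) (m≤n+m _ _)

two-members : ∀ {n h} (c : Fin (suc n) → Fin h) {i} w →
  c zero ≡ i → c (suc w) ≡ i → 2 ≤ classSize c i
two-members c {i} w c0 cw =
  subst (λ z → 2 ≤ z + classSize (c ∘ suc) i) (≡-sym (𝟙-yes (c zero ≟ _) c0)) (s≤s (classSize-pos (c ∘ suc) w cw))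

Singleton : ∀ {n h} → (Fin n → Fin h) → Fin h → Set
Singleton c i = ∀ {u v} → c u ≡ i → c v ≡ i → u ≡ v

small⇒singleton : ∀ {n h} (c : Fin n → Fin h) {i} → classSize c i ≤ 1 → Singleton c i
small⇒singleton c small {zero}  {zero}  _  _  = refl
small⇒singleton c small {zero}  {suc v} cu cv = contradiction (≤-trans (two-members c v cu cv) small) 1+n≰n
small⇒singleton c small {suc u} {zero}  cu cv = contradiction (≤-trans (two-members c u cv cu) small) 1+n≰n
small⇒singleton c small {suc u} {suc v} cu cv =
  cong suc (small⇒singleton (c ∘ suc) (≤-trans (m≤n+m _ _) small) cu cv)

two≤size+small : ∀ {w} (w≤?1 : Dec (w ≤ 1)) → 1 ≤ w → 2 ≤ w + 𝟙 w≤?1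
two≤size+small     (yes _)   1≤w = +-monoˡ-≤ 1 1≤w
two≤size+small {w} (no  w≰1) _   = ≤-trans (≰⇒> w≰1) (m≤m+n w 0)

singletonCount : ∀ {n h} (c : Fin n → Fin h) → (∀ i → ∃ λ v → c v ≡ i) →
  2 * h ≤ n + count (λ i → classSize c i ≤? 1)
singletonCount {n} {h} c onto = begin
  2 * h                                               ≡⟨ *-comm 2 h ⟩
  h * 2                                               ≡⟨ ≡-sym (sum-const h 2) ⟩
  ∑[ i < h ] 2                                        ≤⟨ sum-mono nonempty ⟩
  ∑[ i < h ] (classSize c i + 𝟙 (classSize c i ≤? 1)) ≡⟨ sum-+ (classSize c) _ ⟩
  sum (classSize c) + #small                          ≡⟨ cong (_+ #small) (sum-classSize c) ⟩
  n + #small                                          ∎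
  where
  open ≤-Reasoning
  #small = count (λ i → classSize c i ≤? 1)
  nonempty : ∀ i → 2 ≤ classSize c i + 𝟙 (classSize c i ≤? 1)
  nonempty i = two≤size+small (classSize c i ≤? 1) (classSize-pos c (proj₁ (onto i)) (proj₂ (onto i)))

singletonClasses : ∀ {n h m} (c : Fin n → Fin h) → (∀ i → ∃ λ v → c v ≡ i) →
  n + m ≤ 2 * h → Σ (Fin m → Fin h) λ t → Inj t × (∀ j → Singleton c (t j))
singletonClasses {n} c onto bound =
  let t , inj , small = choose (λ i → classSize c i ≤? 1)
                          (+-cancelˡ-≤ n _ _ (≤-trans bound (singletonCount c onto)))
  in t , inj , λ j → small⇒singleton c (small j)

-- Colours are natural numbers (0 is the first colour); nothing = uncoloured.
PartialColouring : ℕ → Set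
PartialColouring n = Fin n → Maybe ℕ

module _ {n : ℕ} (G : Graph n) where

  record PartialGrundy (ψ : PartialColouring n) (B : ℕ) : Set where
    field
      proper  : ∀ {u v c} → Adj G u v → ψ u ≡ just c → ψ v ≢ just c
      grundy  : ∀ {v c} i → ψ v ≡ just c → i < c → ∃ λ u → Adj G v u × ψ u ≡ just i
      bounded : ∀ {v c} → ψ v ≡ just c → c ≤ B

  totalGrundy : ∀ {ψ B} → PartialGrundy ψ B →
    (col : Fin n → ℕ) → (∀ v → ψ v ≡ just (col v)) →
    ∀ s → Σ ℕ λ k → col s < k × Σ (Fin n → Fin k) (GrundyColoring G k)
  totalGrundy pg col ψ≡col s =
    suc (col top) , s≤s (below-top s) , κ , proper , onto , grundy
    where
    top : Fin n
    top = argmax col s (allFin n)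
    below-top : ∀ v → col v ≤ col top
    below-top v = All.lookup (f[xs]≤f[argmax] s (allFin n)) (∈-allFin v)
    κ : Fin n → Fin (suc (col top))
    κ v = fromℕ< (s≤s (below-top v))
    toℕ-κ : ∀ v → toℕ (κ v) ≡ col v
    toℕ-κ v = toℕ-fromℕ< (s≤s (below-top v))
    proper : ∀ u v → Adj G u v → κ u ≢ κ v
    proper u v a κu≡κv = PartialGrundy.proper pg a (ψ≡col u)
      (trans (ψ≡col v) (cong just (trans (≡-sym (toℕ-κ v)) (trans (cong toℕ (≡-sym κu≡κv)) (toℕ-κ u)))))
    grundy : ∀ v i → toℕ i < toℕ (κ v) → ∃ λ u → Adj G v u × κ u ≡ i
    grundy v i i<κv =
      let u , a , ψu = PartialGrundy.grundy pg (toℕ i) (ψ≡col v) (subst (toℕ i <_) (toℕ-κ v) i<κv)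
      in u , a , toℕ-injective (trans (toℕ-κ u) (just-injective (trans (≡-sym (ψ≡col u)) ψu)))
    -- colours below the top one occur around the top vertex
    onto : ∀ i → ∃ λ v → κ v ≡ i
    onto i with m≤n⇒m<n∨m≡n (s≤s⁻¹ (toℕ<n i))
    ... | inj₁ i<top =
      let u , _ , κu = grundy top i (subst (toℕ i <_) (≡-sym (toℕ-κ top)) i<top) in u , κu
    ... | inj₂ i≡top = top , toℕ-injective (trans (toℕ-κ top) (≡-sym i≡top))

module GreedyExtension {n : ℕ} (G : Graph n) (adj? : ∀ u v → Dec (Adj G u v)) where

  _⊑_ : PartialColouring n → PartialColouring n → Set
  ψ ⊑ ψ' = ∀ {v c} → ψ v ≡ just c → ψ' v ≡ just c

  SeenAt : PartialColouring n → Fin n → ℕ → Set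
  SeenAt ψ v i = ∃ λ u → Adj G v u × ψ u ≡ just i

  seenAt? : ∀ ψ v i → Dec (SeenAt ψ v i)
  seenAt? ψ v i = any? λ u → adj? v u ×-dec ≡-dec-Maybe _≟ℕ_ (ψ u) (just i)

  -- The least colour not seen around v; as colours are at most B it is ≤ B + 1.
  leastUnseen : ∀ {ψ B} → PartialGrundy G ψ B → ∀ v →
    ∃ λ m → ¬ SeenAt ψ v m × (∀ i → i < m → SeenAt ψ v i) × m ≤ suc B
  leastUnseen {ψ} {B} pg v =
    let m , unseen , below = ¬∀⟶∃¬-smallest (suc (suc B)) (SeenAt ψ v ∘ toℕ)
                               (seenAt? ψ v ∘ toℕ) notAllSeen
    in toℕ m , unseen , seenBelow below , toℕ≤pred[n] m
    where
    notAllSeen : ¬ (∀ i → SeenAt ψ v (toℕ i))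
    notAllSeen seen =
      let _ , _ , ψu = seen (fromℕ (suc B))
      in 1+n≰n (subst (_≤ B) (toℕ-fromℕ (suc B)) (PartialGrundy.bounded pg ψu))
    seenBelow : ∀ {m} → (∀ j → SeenAt ψ v (toℕ (inject {i = m} j))) →
      ∀ i → i < toℕ m → SeenAt ψ v i
    seenBelow below i i<m =
      subst (SeenAt ψ v) (trans (toℕ-inject (fromℕ< i<m)) (toℕ-fromℕ< i<m)) (below (fromℕ< i<m))

  module Assign {ψ B} (pg : PartialGrundy G ψ B) (v : Fin n) (uncoloured : ψ v ≡ nothing) where
    m : ℕ
    m = proj₁ (leastUnseen pg v)
    unseen : ¬ SeenAt ψ v m
    unseen = proj₁ (proj₂ (leastUnseen pg v))
    below : ∀ i → i < m → SeenAt ψ v i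
    below = proj₁ (proj₂ (proj₂ (leastUnseen pg v)))
    m≤1+B : m ≤ suc B
    m≤1+B = proj₂ (proj₂ (proj₂ (leastUnseen pg v)))

    ψ' : PartialColouring n
    ψ' = updateAt ψ v (const (just m))

    at : ∀ u → (u ≡ v × ψ' u ≡ just m) ⊎ (ψ' u ≡ ψ u)
    at u with u ≟ v
    ... | yes refl = inj₁ (refl , updateAt-updates v ψ)
    ... | no  u≢v  = inj₂ (updateAt-minimal u v ψ u≢v)

    extends : ψ ⊑ ψ'
    extends {u} ψu with at u
    ... | inj₁ (refl , _) = contradiction (trans (≡-sym uncoloured) ψu) λ ()
    ... | inj₂ ψ'u        = trans ψ'u ψu

    -- v has no neighbour of colour m and sees all smaller colours, so the
    -- Grundy property survives; the bound grows by at most one.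
    pg' : PartialGrundy G ψ' (suc B)
    PartialGrundy.proper pg' {u} {w} a ψ'u ψ'w with at u | at w
    ... | inj₁ (refl , _)   | inj₁ (refl , _)   = irrefl G a
    ... | inj₁ (refl , ψ'v) | inj₂ ψ'w≡ψw      =
      unseen (w , a , trans (≡-sym ψ'w≡ψw) (trans ψ'w (trans (≡-sym ψ'u) ψ'v)))
    ... | inj₂ ψ'u≡ψu      | inj₁ (refl , ψ'v) =
      unseen (u , Graph.sym G a , trans (≡-sym ψ'u≡ψu) (trans ψ'u (trans (≡-sym ψ'w) ψ'v)))
    ... | inj₂ ψ'u≡ψu      | inj₂ ψ'w≡ψw      =
      PartialGrundy.proper pg a (trans (≡-sym ψ'u≡ψu) ψ'u) (trans (≡-sym ψ'w≡ψw) ψ'w)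
    PartialGrundy.grundy pg' {w} i ψ'w i<c with at w
    ... | inj₁ (refl , ψ'v) =
      let u , a , ψu = below i (subst (i <_) (just-injective (trans (≡-sym ψ'w) ψ'v)) i<c)
      in u , a , extends ψu
    ... | inj₂ ψ'w≡ψw =
      let u , a , ψu = PartialGrundy.grundy pg i (trans (≡-sym ψ'w≡ψw) ψ'w) i<c
      in u , a , extends ψu
    PartialGrundy.bounded pg' {w} ψ'w with at w
    ... | inj₁ (refl , ψ'v) = subst (_≤ suc B) (just-injective (trans (≡-sym ψ'v) ψ'w)) m≤1+B
    ... | inj₂ ψ'w≡ψw      = m≤n⇒m≤1+n (PartialGrundy.bounded pg (trans (≡-sym ψ'w≡ψw) ψ'w))

  colourVertex : ∀ {ψ B} → PartialGrundy G ψ B → ∀ v → ψ v ≡ nothing →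
    Σ (PartialColouring n) λ ψ' → PartialGrundy G ψ' (suc B) × ψ ⊑ ψ' × ∃ λ c → ψ' v ≡ just c
  colourVertex {ψ} pg v uncoloured = ψ' , pg' , extends , m , updateAt-updates v ψ
    where open Assign pg v uncoloured

  Coloured : PartialColouring n → Fin n → Set
  Coloured ψ v = ∃ λ c → ψ v ≡ just c

  colourList : ∀ (vs : List (Fin n)) {ψ B} → PartialGrundy G ψ B →
    Σ (PartialColouring n) λ ψ' → Σ ℕ λ B' →
      PartialGrundy G ψ' B' × ψ ⊑ ψ' × All (Coloured ψ') vs
  colourList [] pg = _ , _ , pg , (λ ψv → ψv) , []
  colourList (v ∷ vs) {ψ} pg with ψ v in ψv
  ... | just c =
    let ψ' , B' , pg' , ext , coloured = colourList vs pg
    in ψ' , B' , pg' , ext , (c , ext ψv) ∷ coloured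
  ... | nothing =
    let ψ₁ , pg₁ , ext₁ , c , ψ₁v       = colourVertex pg v ψv
        ψ' , B' , pg' , ext , coloured = colourList vs pg₁
    in ψ' , B' , pg' , (λ ψu → ext (ext₁ ψu)) , (c , ext ψ₁v) ∷ coloured

  grundyExtension : ∀ {ψ B s c} → PartialGrundy G ψ B → ψ s ≡ just c →
    Σ ℕ λ k → c < k × Σ (Fin n → Fin k) (GrundyColoring G k)
  grundyExtension {s = s} pg ψs =
    let ψ' , _ , pg' , ext , allColoured = colourList (allFin n) pg
        coloured v = All.lookup allColoured (∈-allFin v)
        k , col[s]<k , κ = totalGrundy G pg' (proj₁ ∘ coloured) (proj₂ ∘ coloured) s
    in k , subst (_< k) (just-injective (trans (≡-sym (proj₂ (coloured s))) (ext ψs))) col[s]<k , κ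

-- Let c be a complete colouring and t an injective list of m + 1 of its
-- colours whose classes t 1, …, t m are singletons.  Giving every vertex of
-- class t j the colour j is a partial Grundy colouring: a vertex of colour
-- j > 0 is the whole class t j, which completeness joins to every other class.

module Seed {n h m : ℕ} (G : Graph n) (c : Fin n → Fin h)
  (complete : CompleteColoring G h c)
  (t : Fin (suc m) → Fin h) (t-inj : Inj t)
  (singleton : ∀ j → Singleton c (t (suc j))) where

  seed : PartialColouring n
  seed v with any? (λ j → t j ≟ c v)
  ... | yes (j , _) = just (toℕ j)
  ... | no  _       = nothing

  seed-inv : ∀ {v k} → seed v ≡ just k → ∃ λ j → toℕ j ≡ k × t j ≡ c v
  seed-inv {v} seed[v] with any? (λ j → t j ≟ c v)
  ... | yes (j , tj≡cv) = j , just-injective seed[v] , tj≡cv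
  ... | no  _           = contradiction seed[v] λ ()

  seed-class : ∀ {j v} → t j ≡ c v → seed v ≡ just (toℕ j)
  seed-class {j} {v} tj≡cv with any? (λ j → t j ≟ c v)
  ... | yes (j′ , tj′≡cv) = cong (just ∘ toℕ) (t-inj (trans tj′≡cv (≡-sym tj≡cv)))
  ... | no  none          = contradiction (j , tj≡cv) none

  sees : ∀ {v} j → t (suc j) ≡ c v → ∀ i → i < suc (toℕ j) →
    ∃ λ u → Adj G v u × seed u ≡ just i
  sees {v} j tj≡cv i i≤j =
    let u , w , a , cu , cw = proj₂ (proj₂ complete) (t (suc j)) (t l) distinct
    in w , subst (λ x → Adj G x w) (singleton j cu (≡-sym tj≡cv)) a ,
       trans (seed-class (≡-sym cw)) (cong just (toℕ-fromℕ< i<1+m))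
    where
    i<1+m : i < suc m
    i<1+m = <-trans i≤j (toℕ<n (suc j))
    l : Fin (suc m)
    l = fromℕ< i<1+m
    distinct : t (suc j) ≢ t l
    distinct e = <-irrefl (trans (≡-sym (toℕ-fromℕ< i<1+m)) (cong toℕ (≡-sym (t-inj e)))) i≤j

  partialGrundy : PartialGrundy G seed m
  PartialGrundy.proper partialGrundy {u} {v} a seed[u] seed[v] =
    let j , j≡k , tj≡cu = seed-inv seed[u]
        j′ , j′≡k , tj′≡cv = seed-inv seed[v]
    in proj₁ complete u v a
         (trans (≡-sym tj≡cu) (trans (cong t (toℕ-injective (trans j≡k (≡-sym j′≡k)))) tj′≡cv))
  PartialGrundy.grundy partialGrundy i seed[v] i<k with seed-inv seed[v]
  ... | zero  , refl , _     = contradiction i<k λ ()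
  ... | suc j , refl , tj≡cv = sees j tj≡cv i i<k
  PartialGrundy.bounded partialGrundy seed[v] =
    let j , j≡k , _ = seed-inv seed[v] in subst (_≤ m) j≡k (toℕ≤pred[n] j)

  topVertex : ∃ λ s → seed s ≡ just m
  topVertex =
    let s , cs = proj₁ (proj₂ complete) (t (fromℕ m))
    in s , trans (seed-class (≡-sym cs)) (cong just (toℕ-fromℕ m))

largeGrundy : ∀ {n h m} (G : Graph n) → (∀ u v → Dec (Adj G u v)) →
  (c : Fin n → Fin h) → CompleteColoring G h c → m < h → n + m ≤ 2 * h →
  Σ ℕ λ k → m < k × Σ (Fin n → Fin k) (GrundyColoring G k)
largeGrundy G adj? c complete m<h bound =
  GreedyExtension.grundyExtension G adj? partialGrundy (proj₂ topVertex)
  where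
  -- m colours t with singleton classes, and a colour x outside them; the seed
  -- is built from the list x, t₁, …, t_m.
  singles = singletonClasses c (proj₁ (proj₂ complete)) bound
  fresh   = missed-value m<h (proj₁ singles)
  open Seed G c complete (proj₁ fresh ∷ᵛ proj₁ singles)
              (cons-injective (proj₂ fresh) (proj₁ (proj₂ singles))) (proj₂ (proj₂ singles))

¬¬-∀ : ∀ {k} {P : Fin k → Set} → (∀ i → ¬ ¬ P i) → ¬ ¬ (∀ i → P i)
¬¬-∀ {zero}  _   ¬all = ¬all λ ()
¬¬-∀ {suc k} ¬¬P ¬all = ¬¬P zero λ p₀ → ¬¬-∀ (¬¬P ∘ suc) λ ps → ¬all (∀-cons p₀ ps)

¬¬-adjacency-decidable : ∀ {n} (G : Graph n) → ¬ ¬ (∀ u v → Dec (Adj G u v))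
¬¬-adjacency-decidable G = ¬¬-∀ λ u → ¬¬-∀ λ v → ¬¬-excluded-middle

short⇒bound : ∀ {a b n} → b ≤ a → ¬ (a ∸ b + 1 ≤ n) → n + b ≤ a
short⇒bound {a} {b} {n} b≤a short = begin
  n + b     ≤⟨ +-monoˡ-≤ b (m<1+n⇒m≤n (subst (n <_) (+-comm (a ∸ b) 1) (≰⇒> short))) ⟩
  a ∸ b + b ≡⟨ m∸n+n≡m b≤a ⟩
  a         ∎
  where open ≤-Reasoning

lemma2 : (f g h : ℕ) → 2 < f → f ≡ g → g < h →
    (n : ℕ) (G : Graph n) → Connected G →
    ChromaticNumber G f → GrundyNumber G g → AchromaticNumber G h →
    2 * h ∸ f + 1 ≤ n
lemma2 f .f h _ refl f<h n G _ _ (_ , grundy≤f) ((c , complete) , _) =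
  decidable-stable (2 * h ∸ f + 1 ≤? n) λ short →
    ¬¬-adjacency-decidable G λ adj? →
      let k , f<k , κ = largeGrundy G adj? c complete f<h (short⇒bound f≤2h short)
      in <⇒≱ f<k (grundy≤f k κ)
  where
  f≤2h : f ≤ 2 * h
  f≤2h = ≤-trans (<⇒≤ f<h) (m≤m+n h (h + 0))
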